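{- Suppose the Hurwitz Goldbach conjecture holds: every Lipschitz integer $(a,b,c,d)$ (all coordinates integers) with $a,b,c,d>1$ is a sum $p+q$ of two Hurwitz primes $p,q$ all of whose coordinates are positive. Then at least one of the sequences $(1+k+k^2)_{k\ge 0}$ and $(3+k+k^2)_{k\ge 0}$ contains infinitely many rational primes.
   Context: Quaternions $a+bi+cj+dk$ are identified with $(a,b,c,d)\in\mathbb{R}^4$, with norm $N(a,b,c,d)=a^2+b^2+c^2+d^2$. A Lipschitz integer is an element of $\mathbb{Z}^4$. A Hurwitz prime is an element of $\mathbb{Z}^4+(\tfrac12,\tfrac12,\tfrac12,\tfrac12)$ (all four coordinates half-odd integers) whose norm is a rational prime. -}

module Defs where

open import Data.Nat using (ℕ; _≤_)
open import Data.Nat.Primality using (Prime)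
open import Data.Integer using (ℤ; +_; _+_; _*_; _<_)
open import Data.Product using (Σ; ∃; _×_)
open import Relation.Binary.PropositionalEquality using (_≡_)
open import Relation.Nullary using (¬_)

-- A quadruple of integers (standing for a quaternion a + bi + cj + dk).
record Quad : Set where
  constructor quad
  field
    x₀ x₁ x₂ x₃ : ℤ
open Quad public

OddInt : ℤ → Set
OddInt z = ∃ λ m → z ≡ + 2 * m + + 1

-- ENCODING of quaternions with half-integer coordinates:
-- a quaternion h = (h₀,h₁,h₂,h₃) ∈ (½ℤ)⁴ is represented by its DOUBLE
-- 2h = (2h₀,2h₁,2h₂,2h₃) ∈ ℤ⁴.  Then
--   * all coordinates of h are half-odd integers  ⟺  all coords of 2h are odd;
--   * N(h) = (sum of squares of coords of 2h) / 4;
--   * h has positive coordinates ⟺ 2h has positive coordinates;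
--   * h + h' = L (L Lipschitz)  ⟺  2h + 2h' = 2L.

sumSq : Quad → ℤ
sumSq (quad a b c d) = a * a + b * b + c * c + d * d

-- "Q is the double of a Hurwitz prime": all coordinates of Q/2 are
-- half-odd integers and N(Q/2) = sumSq Q / 4 is a rational prime p.
IsDoubledHurwitzPrime : Quad → Set
IsDoubledHurwitzPrime Q =
  OddInt (x₀ Q) × OddInt (x₁ Q) × OddInt (x₂ Q) × OddInt (x₃ Q) ×
  (∃ λ (p : ℕ) → Prime p × sumSq Q ≡ + 4 * + p)

AllPositive : Quad → Set
AllPositive Q = + 0 < x₀ Q × + 0 < x₁ Q × + 0 < x₂ Q × + 0 < x₃ Q

AllGreaterThanOne : Quad → Set
AllGreaterThanOne Q = + 1 < x₀ Q × + 1 < x₁ Q × + 1 < x₂ Q × + 1 < x₃ Q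

_⊕_ : Quad → Quad → Quad
quad a b c d ⊕ quad a' b' c' d' = quad (a + a') (b + b') (c + c') (d + d')

double : Quad → Quad
double (quad a b c d) = quad (+ 2 * a) (+ 2 * b) (+ 2 * c) (+ 2 * d)

-- Hurwitz Goldbach conjecture: every Lipschitz integer L with all
-- coordinates > 1 is p + q with p, q Hurwitz primes with positive
-- coordinates.  (P, Q below are the doubles 2p, 2q.)
HurwitzGoldbach : Set
HurwitzGoldbach =
  (L : Quad) → AllGreaterThanOne L →
  ∃ λ P → ∃ λ Q →
    IsDoubledHurwitzPrime P × AllPositive P ×
    IsDoubledHurwitzPrime Q × AllPositive Q ×
    P ⊕ Q ≡ double L

FinitelyManyPrimes : (ℕ → ℕ) → Set
FinitelyManyPrimes f = ∃ λ N → (k : ℕ) → N ≤ k → ¬ Prime (f k)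

-- Take L = (2,2,2,s+1). Doubling the Hurwitz primes p, q with p + q = L, every coordinate of
-- 2p and 2q is odd and positive, so the first three coordinates of 2p are 1 or 3 (those of 2q
-- being complementary) and the last ones are 2a+1 and 2b+1 with a + b = s.  Hence
-- N(p) = a² + a + c and N(q) = b² + b + c′ where c = 1 + 2·#{coordinates equal to 3} and
-- c + c′ = 8; swapping p and q we may take c ∈ {1, 3} and c′ ∈ {5, 7}.  If both sequences
-- k² + k + 1 and k² + k + 3 are composite beyond N, primality of N(p) forces a < N.  Choose s > 2N
-- divisible by every k² + k + 5 and k² + k + 7 with k < N.  As b ≡ −a (mod s), the number
-- b² + b + c′ is congruent to (a−1)² + (a−1) + c′ = a² − a + c′, which divides s, so it is a
-- proper multiple of it, contradicting primality.
module Submission where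

open import Defs
open import Data.Nat using (ℕ; _+_; _*_)
open import Data.Product using (_×_)
open import Relation.Nullary using (¬_)

open import Data.Nat using (zero; suc; _∸_; _≤_; _<_; z≤n; s≤s; _≤?_; >-nonZero; NonTrivial; n>1⇒nonTrivial)
open import Data.Nat.Properties
open import Data.Nat.Divisibility using (_∣_; ∣-trans; ∣-refl; m∣m*n; n∣m*n; ∣m∣n⇒∣m+n)
open import Data.Nat.Primality using (Prime; composite-≢; composite⇒¬prime)
open import Data.Nat.ListAction using (product)
open import Data.Nat.ListAction.Properties using (∈⇒∣product; ∈⇒≤product)
open import Data.Nat.Tactic.RingSolver using (solve-∀)
open import Data.Integer as ℤ using (+_; -[1+_])
import Data.Integer.Properties as ℤ
open import Data.List using (List; _∷_; map; upTo)
open import Data.List.Relation.Unary.All using (_∷_; universal)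
import Data.List.Relation.Unary.All.Properties as All
open import Data.List.Relation.Unary.Any using (here; there)
open import Data.List.Membership.Propositional.Properties using (∈-map⁺; ∈-upTo⁺)
open import Data.Product using (∃; ∃₂; _,_)
open import Data.Sum using (_⊎_; inj₁; inj₂)
open import Data.Empty using (⊥-elim)
open import Relation.Nullary using (yes; no)
open import Relation.Binary.PropositionalEquality

trinomial : ℕ → ℕ → ℕ
trinomial c k = c + k + k * k

Small Large : ℕ → Set
Small c = c ≡ 1 ⊎ c ≡ 3
Large c = c ≡ 5 ⊎ c ≡ 7

-- k² + k + c is invariant under k ↦ −1 − k, so its value at −a is its value at a − 1.
trinomial-shift : ∀ c a d → trinomial c (a + d) ≡ trinomial c (a ∸ 1) + (a + (a + d)) * suc d
trinomial-shift c zero    d = at-zero c d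
  where
  at-zero : ∀ c d → c + d + d * d ≡ c + 0 + 0 * 0 + d * suc d
  at-zero = solve-∀
trinomial-shift c (suc a) d = at-suc c a d
  where
  at-suc : ∀ c a d → c + suc (a + d) + suc (a + d) * suc (a + d) ≡
                     c + a + a * a + suc (a + suc (a + d)) * suc d
  at-suc = solve-∀

trinomial-nonTrivial : ∀ {c} k → 1 < c → 1 < trinomial c k
trinomial-nonTrivial {c} k 1<c = <-≤-trans 1<c (≤-trans (m≤m+n c k) (m≤m+n (c + k) (k * k)))

trinomial-¬prime : ∀ {c a b} → 1 < c → a ≤ b → 0 < a + b →
                   trinomial c (a ∸ 1) ∣ a + b → ¬ Prime (trinomial c b)
trinomial-¬prime {c} {a} 1<c a≤b 0<a+b D∣a+b
  with d , refl ← m≤n⇒∃[o]m+o≡n a≤b rewrite trinomial-shift c a d =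
  composite⇒¬prime (composite-≢ D {{D-nonTrivial}} {{>-nonZero 0<D+X}}
                                 (<⇒≢ (m<m+n D 0<X))
                                 (∣m∣n⇒∣m+n ∣-refl (∣-trans D∣a+b (m∣m*n (suc d)))))
  where
  D X : ℕ
  D = trinomial c (a ∸ 1)
  X = (a + (a + d)) * suc d
  D-nonTrivial : NonTrivial D
  D-nonTrivial = n>1⇒nonTrivial (trinomial-nonTrivial (a ∸ 1) 1<c)
  0<X : 0 < X
  0<X = <-≤-trans 0<a+b (m≤m*n (a + (a + d)) (suc d))
  0<D+X : 0 < D + X
  0<D+X = <-≤-trans 0<X (m≤n+m X D)

¬bothPrime : ∀ {N c c′ s a b} → (∀ k → N ≤ k → ¬ Prime (trinomial c k)) → 1 < c′ →
             (∀ k → k < N → trinomial c′ k ∣ s) → N + N < s →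
             a + b ≡ s → Prime (trinomial c a) → ¬ Prime (trinomial c′ b)
¬bothPrime {N} {a = a} {b} composite≥N 1<c′ ∣s N+N<s refl prime-a with N ≤? a
... | yes N≤a = λ _ → composite≥N a N≤a prime-a
... | no N≰a  =
  trinomial-¬prime 1<c′ a≤b (≤-<-trans z≤n N+N<s) (∣s (a ∸ 1) (≤-<-trans (m∸n≤m a 1) a<N))
  where
  a<N : a < N
  a<N = ≰⇒> N≰a
  a≤b : a ≤ b
  a≤b = ≮⇒≥ λ b<a → <-asym N+N<s (+-mono-< a<N (<-trans b<a a<N))

trinomial₅₇ : ℕ → ℕ
trinomial₅₇ k = trinomial 5 k * trinomial 7 k

modulusFactors : ℕ → List ℕ
modulusFactors N = suc (N + N) ∷ map trinomial₅₇ (upTo N)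

modulus : ℕ → ℕ
modulus N = product (modulusFactors N)

modulus-large : ∀ N → N + N < modulus N
modulus-large N = ∈⇒≤product (_ ∷ All.map⁺ (universal (λ _ → _) (upTo N))) (here refl)

large⇒1< : ∀ {c} → Large c → 1 < c
large⇒1< (inj₁ refl) = s≤s (s≤s z≤n)
large⇒1< (inj₂ refl) = s≤s (s≤s z≤n)

trinomial∣modulus : ∀ {c} N → Large c → ∀ k → k < N → trinomial c k ∣ modulus N
trinomial∣modulus N large k k<N =
  ∣-trans (∣product large)
          (∈⇒∣product {ns = modulusFactors N} (there (∈-map⁺ trinomial₅₇ (∈-upTo⁺ k<N))))
  where
  ∣product : ∀ {c} → Large c → trinomial c k ∣ trinomial₅₇ k
  ∣product (inj₁ refl) = m∣m*n (trinomial 7 k)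
  ∣product (inj₂ refl) = n∣m*n (trinomial 5 k)

positiveOdd : ∀ {z} → OddInt z → + 0 ℤ.< z → ∃ λ u → z ≡ + suc (2 * u)
positiveOdd (+ u , refl) _ =
  u , trans (cong (ℤ._+ + 1) (sym (ℤ.pos-* 2 u))) (cong +_ (+-comm (2 * u) 1))
positiveOdd (-[1+ k ] , refl) 0<z =
  ⊥-elim (negative (subst (+ 0 ℤ.<_) (cong (ℤ._+ + 1) (2*≡+ -[1+ k ])) 0<z))
  where
  2*≡+ : ∀ m → + 2 ℤ.* m ≡ m ℤ.+ m
  2*≡+ m = trans (ℤ.*-distribʳ-+ m (+ 1) (+ 1)) (cong₂ ℤ._+_ (ℤ.*-identityˡ m) (ℤ.*-identityˡ m))
  negative : ¬ (+ 0 ℤ.< -[1+ k ] ℤ.+ -[1+ k ] ℤ.+ + 1)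
  negative ()

oddQuad : ℕ → ℕ → ℕ → ℕ → Quad
oddQuad u₀ u₁ u₂ u₃ = quad (+ suc (2 * u₀)) (+ suc (2 * u₁)) (+ suc (2 * u₂)) (+ suc (2 * u₃))

oddQuad-view : ∀ {P} → OddInt (x₀ P) → OddInt (x₁ P) → OddInt (x₂ P) → OddInt (x₃ P) →
               AllPositive P → ∃₂ λ u₀ u₁ → ∃₂ λ u₂ u₃ → P ≡ oddQuad u₀ u₁ u₂ u₃
oddQuad-view {quad _ _ _ _} o₀ o₁ o₂ o₃ (p₀ , p₁ , p₂ , p₃)
  with u₀ , refl ← positiveOdd o₀ p₀
  with u₁ , refl ← positiveOdd o₁ p₁
  with u₂ , refl ← positiveOdd o₂ p₂
  with u₃ , refl ← positiveOdd o₃ p₃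
  = u₀ , u₁ , u₂ , u₃ , refl

offset : ℕ → ℕ → ℕ → ℕ
offset u₀ u₁ u₂ = 1 + u₀ * suc u₀ + u₁ * suc u₁ + u₂ * suc u₂

-- On positive arguments ℤ's + and * compute, so sumSq (oddQuad …) is literally + (Σ (2uᵢ+1)²).
norm-oddQuad : ∀ u₀ u₁ u₂ u₃ {p} → sumSq (oddQuad u₀ u₁ u₂ u₃) ≡ + 4 ℤ.* + p →
               p ≡ trinomial (offset u₀ u₁ u₂) u₃
norm-oddQuad u₀ u₁ u₂ u₃ {p} norm =
  *-cancelˡ-≡ p _ 4 (trans (ℤ.+-injective (trans (ℤ.pos-* 4 p) (sym norm)))
                           (oddSquares u₀ u₁ u₂ u₃))
  where
  oddSquares : ∀ u₀ u₁ u₂ u₃ →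
    suc (2 * u₀) * suc (2 * u₀) + suc (2 * u₁) * suc (2 * u₁) +
    suc (2 * u₂) * suc (2 * u₂) + suc (2 * u₃) * suc (2 * u₃) ≡
    4 * (1 + u₀ * suc u₀ + u₁ * suc u₁ + u₂ * suc u₂ + u₃ + u₃ * u₃)
  oddSquares = solve-∀

positiveHurwitzPrime : ∀ {P} → IsDoubledHurwitzPrime P → AllPositive P →
  ∃₂ λ u₀ u₁ → ∃₂ λ u₂ u₃ → P ≡ oddQuad u₀ u₁ u₂ u₃ × Prime (trinomial (offset u₀ u₁ u₂) u₃)
positiveHurwitzPrime (o₀ , o₁ , o₂ , o₃ , p , p-prime , norm) positive
  with u₀ , u₁ , u₂ , u₃ , refl ← oddQuad-view o₀ o₁ o₂ o₃ positive
  = u₀ , u₁ , u₂ , u₃ , refl , subst Prime (norm-oddQuad u₀ u₁ u₂ u₃ norm) p-prime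

odd+odd-half : ∀ u v w → suc (2 * u) + suc (2 * v) ≡ 2 * suc w → u + v ≡ w
odd+odd-half u v w e =
  suc-injective (*-cancelˡ-≡ (suc (u + v)) (suc w) 2 (trans (sym (oddSum u v)) e))
  where
  oddSum : ∀ x y → suc (2 * x) + suc (2 * y) ≡ 2 * suc (x + y)
  oddSum = solve-∀

data Complementary : ℕ → ℕ → Set where
  0+1 : Complementary 0 1
  1+0 : Complementary 1 0

complementary : ∀ u v → u + v ≡ 1 → Complementary u v
complementary zero       _    refl = 0+1
complementary 1          zero refl = 1+0
complementary 1          (suc _) ()
complementary (suc (suc _)) _ ()

offsets : ∀ {u₀ u₁ u₂ v₀ v₁ v₂} →
  Complementary u₀ v₀ → Complementary u₁ v₁ → Complementary u₂ v₂ →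
  Small (offset u₀ u₁ u₂) × Large (offset v₀ v₁ v₂) ⊎
  Small (offset v₀ v₁ v₂) × Large (offset u₀ u₁ u₂)
offsets 0+1 0+1 0+1 = inj₁ (inj₁ refl , inj₂ refl)
offsets 1+0 0+1 0+1 = inj₁ (inj₂ refl , inj₁ refl)
offsets 0+1 1+0 0+1 = inj₁ (inj₂ refl , inj₁ refl)
offsets 0+1 0+1 1+0 = inj₁ (inj₂ refl , inj₁ refl)
offsets 1+0 1+0 0+1 = inj₂ (inj₂ refl , inj₁ refl)
offsets 1+0 0+1 1+0 = inj₂ (inj₂ refl , inj₁ refl)
offsets 0+1 1+0 1+0 = inj₂ (inj₂ refl , inj₁ refl)
offsets 1+0 1+0 1+0 = inj₂ (inj₁ refl , inj₂ refl)

record TrinomialSplit (s : ℕ) : Set where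
  field
    c c′ a b : ℕ
    small   : Small c
    large   : Large c′
    sum     : a + b ≡ s
    prime-a : Prime (trinomial c a)
    prime-b : Prime (trinomial c′ b)

[2,2,2,1+s]>1 : ∀ {s} → 0 < s → AllGreaterThanOne (quad (+ 2) (+ 2) (+ 2) (+ suc s))
[2,2,2,1+s]>1 0<s = 1<2 , 1<2 , 1<2 , ℤ.+<+ (s≤s 0<s)
  where
  1<2 : + 1 ℤ.< + 2
  1<2 = ℤ.+<+ (s≤s (s≤s z≤n))

hurwitzGoldbach⇒trinomialSplit : HurwitzGoldbach → ∀ {s} → 0 < s → TrinomialSplit s
hurwitzGoldbach⇒trinomialSplit HG {s} 0<s
  with P , Q , hP , posP , hQ , posQ , P⊕Q≡2L ← HG (quad (+ 2) (+ 2) (+ 2) (+ suc s)) ([2,2,2,1+s]>1 0<s)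
  with u₀ , u₁ , u₂ , a , refl , prime-a ← positiveHurwitzPrime hP posP
  with v₀ , v₁ , v₂ , b , refl , prime-b ← positiveHurwitzPrime hQ posQ
  with offsets (complementary u₀ v₀ (odd+odd-half u₀ v₀ 1 (ℤ.+-injective (cong x₀ P⊕Q≡2L))))
               (complementary u₁ v₁ (odd+odd-half u₁ v₁ 1 (ℤ.+-injective (cong x₁ P⊕Q≡2L))))
               (complementary u₂ v₂ (odd+odd-half u₂ v₂ 1 (ℤ.+-injective (cong x₂ P⊕Q≡2L))))
     | odd+odd-half a b s (ℤ.+-injective (cong x₃ P⊕Q≡2L))
... | inj₁ (small , large) | a+b≡s =
  record { a = a ; b = b ; small = small ; large = large ; sum = a+b≡s
         ; prime-a = prime-a ; prime-b = prime-b }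
... | inj₂ (small , large) | a+b≡s =
  record { a = b ; b = a ; small = small ; large = large ; sum = trans (+-comm b a) a+b≡s
         ; prime-a = prime-b ; prime-b = prime-a }

mainTheorem7 : HurwitzGoldbach →
    ¬ (FinitelyManyPrimes (λ k → 1 + k + k * k) ×
    FinitelyManyPrimes (λ k → 3 + k + k * k))
mainTheorem7 HG ((N₁ , composite₁) , (N₃ , composite₃)) =
  ¬bothPrime (compositeFrom small) (large⇒1< large) (trinomial∣modulus N large) (modulus-large N)
             sum prime-a prime-b
  where
  N : ℕ
  N = N₁ + N₃
  open TrinomialSplit (hurwitzGoldbach⇒trinomialSplit HG (≤-<-trans z≤n (modulus-large N)))
  compositeFrom : ∀ {c} → Small c → ∀ k → N ≤ k → ¬ Prime (trinomial c k)
  compositeFrom (inj₁ refl) k N≤k = composite₁ k (≤-trans (m≤m+n N₁ N₃) N≤k)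
  compositeFrom (inj₂ refl) k N≤k = composite₃ k (≤-trans (m≤n+m N₃ N₁) N≤k)
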